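{- Let $k$ be a positive integer, let $H$ be any graph, and let $G$ be any graph without isolated vertices. Then \[\gamma_{rk}(G\circ H)\le k\,\gamma_t(G).\]
   Context: All graphs are finite and simple. For a positive integer $k$, a $k$-rainbow dominating function of a graph $X$ is a map $f\colon V(X)\to 2^{\{1,\dots,k\}}$ (subsets of $\{1,\dots,k\}$) such that for every vertex $v$ with $f(v)=\emptyset$ we have $\bigcup_{u\in N(v)} f(u)=\{1,\dots,k\}$, where $N(v)$ is the open neighborhood of $v$. Its weight is $\|f\|=\sum_{v\in V(X)}|f(v)|$, and the $k$-rainbow domination number $\gamma_{rk}(X)$ is the minimum weight of a $k$-rainbow dominating function of $X$. The lexicographic product $G\circ H$ has vertex set $V(G)\times V(H)$, with $(g_1,h_1)$ adjacent to $(g_2,h_2)$ iff $g_1g_2\in E(G)$, or $g_1=g_2$ and $h_1h_2\in E(H)$. For a graph $G$ without isolated vertices, $\gamma_t(G)$ is the total domination number: the minimum size of a set $S\subseteq V(G)$ with $N(S)=V(G)$, i.e. every vertex of $G$ has a neighbor in $S$. -}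

module Defs where

open import Data.Nat using (ℕ; _+_; _*_; _≤_)
open import Data.Fin using (Fin)
open import Data.Fin.Subset using (Subset; _∈_; ⊥; ∣_∣)
open import Data.Product using (Σ; ∃; _×_; _,_)
open import Data.Sum using (_⊎_)
open import Data.List using (List; map; allFin)
open import Data.Nat.ListAction using (sum)
open import Relation.Nullary using (¬_)
open import Relation.Binary.PropositionalEquality using (_≡_)

record Graph : Set₁ where
  field
    n     : ℕ
    Adj   : Fin n → Fin n → Set
    sym   : ∀ {u v} → Adj u v → Adj v u
    irrefl : ∀ {v} → ¬ Adj v v
open Graph public

Vtx : Graph → Set
Vtx X = Fin (n X)

IsRDF : (k : ℕ) {V : Set} (Adj : V → V → Set) (f : V → Subset k) → Set
IsRDF k {V} Adj f =
  ∀ (v : V) → f v ≡ ⊥ → ∀ (i : Fin k) → ∃ λ (u : V) → Adj v u × i ∈ f u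

LexAdj : (G H : Graph) → (Vtx G × Vtx H) → (Vtx G × Vtx H) → Set
LexAdj G H (g₁ , h₁) (g₂ , h₂) = Adj G g₁ g₂ ⊎ (g₁ ≡ g₂ × Adj H h₁ h₂)

weight : (k : ℕ) (G H : Graph) → (Vtx G × Vtx H → Subset k) → ℕ
weight k G H f =
  sum (map (λ g → sum (map (λ h → ∣ f (g , h) ∣) (allFin (n H)))) (allFin (n G)))

IsRainbowDomNumLex : (k : ℕ) (G H : Graph) → ℕ → Set
IsRainbowDomNumLex k G H m =
  (Σ (Vtx G × Vtx H → Subset k) λ f → IsRDF k (LexAdj G H) f × weight k G H f ≡ m)
  × (∀ (f : Vtx G × Vtx H → Subset k) → IsRDF k (LexAdj G H) f → m ≤ weight k G H f)

IsTotalDom : (G : Graph) → Subset (n G) → Set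
IsTotalDom G S = ∀ (v : Vtx G) → ∃ λ (u : Vtx G) → Adj G v u × u ∈ S

IsTotalDomNum : (G : Graph) → ℕ → Set
IsTotalDomNum G t =
  (Σ (Subset (n G)) λ S → IsTotalDom G S × ∣ S ∣ ≡ t)
  × (∀ (S : Subset (n G)) → IsTotalDom G S → t ≤ ∣ S ∣)

NoIsolated : Graph → Set
NoIsolated G = ∀ (v : Vtx G) → ∃ λ (u : Vtx G) → Adj G v u

module Submission where

-- Given a total dominating set S of G, fix the first vertex h₀ of H and give every
-- vertex (g , h₀) with g ∈ S all k colours, every other vertex none.  Any vertex
-- (v , h) has a G-neighbour u ∈ S, and (u , h₀) is adjacent to (v , h) in G ∘ H and
-- carries every colour.  The weight is k ∣ S ∣, and choosing ∣ S ∣ = γₜ(G) gives the bound.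

open import Defs hiding (sym)
open import Data.Bool using (true; false; if_then_else_)
open import Data.Nat using (ℕ; _*_; _+_; _≤_; z≤n; NonZero)
open import Data.Nat.Properties using (*-zeroʳ; *-suc; +-identityʳ; +-mono-≤; ≤-reflexive; ≤-trans; module ≤-Reasoning)
open import Data.Fin using (Fin; zero; suc)
open import Data.Fin.Subset using (Subset; ⊤; ⊥; ∣_∣; _∈_)
open import Data.Fin.Subset.Properties using (∣⊥∣≡0; ∣⊤∣≡n; ∈⊤)
open import Data.Vec using ([]; _∷_; lookup)
open import Data.Vec.Properties using ([]=⇒lookup)
open import Data.List using (List; []; _∷_; map; allFin; tabulate)
open import Data.List.Properties using (map-tabulate)
open import Data.Nat.ListAction using (sum)
open import Data.Product using (_×_; _,_)
open import Data.Sum using (inj₁)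
open import Function using (_∘_)
open import Relation.Binary.PropositionalEquality using (_≡_; refl; sym; trans; cong; cong₂; subst; module ≡-Reasoning)

sum-map-mono : ∀ {a} {A : Set a} {f g : A → ℕ} (xs : List A) →
               (∀ x → f x ≤ g x) → sum (map f xs) ≤ sum (map g xs)
sum-map-mono []       f≤g = z≤n
sum-map-mono (x ∷ xs) f≤g = +-mono-≤ (f≤g x) (sum-map-mono xs f≤g)

sum-tabulate-zero : ∀ {q} {f : Fin q → ℕ} → (∀ i → f i ≡ 0) → sum (tabulate f) ≡ 0
sum-tabulate-zero {ℕ.zero}  f≡0 = refl
sum-tabulate-zero {ℕ.suc q} f≡0 = cong₂ _+_ (f≡0 zero) (sum-tabulate-zero (f≡0 ∘ suc))

fullOn : ∀ {k m} → Subset m → Fin m → Subset k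
fullOn S g = if lookup S g then ⊤ else ⊥

∈-fullOn : ∀ {k m} {S : Subset m} {u : Fin m} (i : Fin k) → u ∈ S → i ∈ fullOn S u
∈-fullOn {S = S} {u} i u∈S = subst (λ b → i ∈ (if b then ⊤ else ⊥)) (sym ([]=⇒lookup u∈S)) ∈⊤

sum-∣fullOn∣ : ∀ k {m} (S : Subset m) → sum (tabulate (∣_∣ ∘ fullOn {k} S)) ≡ k * ∣ S ∣
sum-∣fullOn∣ k []          = sym (*-zeroʳ k)
sum-∣fullOn∣ k (true ∷ S)  = trans (cong₂ _+_ (∣⊤∣≡n k) (sum-∣fullOn∣ k S)) (sym (*-suc k ∣ S ∣))
sum-∣fullOn∣ k (false ∷ S) = cong₂ _+_ (∣⊥∣≡0 k) (sum-∣fullOn∣ k S)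

atFirst : ∀ {k q} → Subset k → Fin q → Subset k
atFirst A zero    = A
atFirst A (suc _) = ⊥

first : ∀ {q} → Fin q → Fin q
first {ℕ.suc _} _ = zero

atFirst-first : ∀ {k q} (A : Subset k) (h : Fin q) → atFirst A (first h) ≡ A
atFirst-first A zero    = refl
atFirst-first A (suc _) = refl

sum-∣atFirst∣≤ : ∀ {k} (A : Subset k) q → sum (map (∣_∣ ∘ atFirst A) (allFin q)) ≤ ∣ A ∣
sum-∣atFirst∣≤ A ℕ.zero     = z≤n
sum-∣atFirst∣≤ {k} A (ℕ.suc q) = ≤-reflexive (begin
  sum (map (∣_∣ ∘ atFirst A) (allFin (ℕ.suc q)))
    ≡⟨ cong sum (map-tabulate {n = ℕ.suc q} (λ h → h) (∣_∣ ∘ atFirst A)) ⟩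
  ∣ A ∣ + sum (tabulate {n = q} (λ _ → ∣ ⊥ {k} ∣))
    ≡⟨ cong (∣ A ∣ +_) (sum-tabulate-zero {q} (λ _ → ∣⊥∣≡0 k)) ⟩
  ∣ A ∣ + 0
    ≡⟨ +-identityʳ ∣ A ∣ ⟩
  ∣ A ∣ ∎)
  where open ≡-Reasoning

colourFirstLayer : ∀ {k m q} → Subset m → Fin m × Fin q → Subset k
colourFirstLayer S (g , h) = atFirst (fullOn S g) h

colourFirstLayer-isRDF : ∀ k (G H : Graph) {S : Subset (n G)} →
                         IsTotalDom G S → IsRDF k (LexAdj G H) (colourFirstLayer S)
colourFirstLayer-isRDF k G H {S} total (v , h) _ i with total v
... | u , vu , u∈S =
  (u , first h) , inj₁ vu , subst (i ∈_) (sym (atFirst-first (fullOn S u) h)) (∈-fullOn i u∈S)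

weight-colourFirstLayer : ∀ k (G H : Graph) (S : Subset (n G)) →
                          weight k G H (colourFirstLayer S) ≤ k * ∣ S ∣
weight-colourFirstLayer k G H S = begin
  weight k G H (colourFirstLayer S)
    ≤⟨ sum-map-mono (allFin (n G)) (λ g → sum-∣atFirst∣≤ (fullOn S g) (n H)) ⟩
  sum (map (∣_∣ ∘ fullOn S) (allFin (n G)))
    ≡⟨ cong sum (map-tabulate (λ g → g) (∣_∣ ∘ fullOn S)) ⟩
  sum (tabulate (∣_∣ ∘ fullOn S))
    ≡⟨ sum-∣fullOn∣ k S ⟩
  k * ∣ S ∣ ∎
  where open ≤-Reasoning

-- Absence of isolated vertices only guarantees that γₜ(G) exists; here t is given.
proposition3 : (k : ℕ) → .{{_ : NonZero k}} → (G H : Graph) → NoIsolated G →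
    (m t : ℕ) → IsRainbowDomNumLex k G H m → IsTotalDomNum G t → m ≤ k * t
proposition3 k G H _ m t (_ , m-minimal) ((S , total , ∣S∣≡t) , _) =
  ≤-trans (m-minimal (colourFirstLayer S) (colourFirstLayer-isRDF k G H total))
          (subst (λ s → weight k G H (colourFirstLayer S) ≤ k * s) ∣S∣≡t (weight-colourFirstLayer k G H S))
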